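{- Let $k\ge2$. The class of pattern counting sequences $\mathbb{N}_0\to\{+1,-1\}$ in base $k$ is closed under pointwise multiplication.
   Context: $\Sigma_k=\{\mathtt 0,\dots,k-1\}$; $(n)_k$ is the base-$k$ expansion of $n$ without leading zeros. For a word $v$ over $\Sigma_k$ not of the form $\mathtt 0^j$ ($j\ge0$) and $n\in\mathbb{N}_0$, $\#(v,n)$ is the number of pairs of words $(x,y)$ with $\mathtt 0^{|v|-1}(n)_k=xvy$ (occurrences with overlaps). A set $A$ of words over $\Sigma_k$ is admissible if it is finite and contains no word of the form $\mathtt 0^j$ ($j\ge 0$); then $a_A(n)=(-1)^{\sum_{v\in A}\#(v,n)}$. A pattern counting sequence is a sequence of the form $a_A$ with $A$ admissible. -}

module Defs where

open import Data.Nat using (ℕ; zero; suc; _+_; _∸_; NonZero)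
open import Data.Nat.DivMod using (_/_; _mod_)
open import Data.Fin using (Fin)
import Data.Fin as Fin
open import Data.List using (List; []; _∷_; _++_; replicate; length; reverse; map)
open import Data.Nat.ListAction using (sum)
open import Data.List.Relation.Unary.All using (All)
open import Data.List.Relation.Unary.Unique.Propositional using (Unique)
open import Data.Integer using (ℤ; -[1+_]; +_) renaming (_^_ to _^ℤ_)
open import Data.Product using (_×_)
open import Relation.Binary.PropositionalEquality using (_≡_)
open import Relation.Nullary using (¬_; yes; no)

Word : ℕ → Set
Word k = List (Fin k)

-- little-endian base-k digits, with fuel (fuel = n suffices since k ≥ 2)
digitsLE : (k : ℕ) → .{{_ : NonZero k}} → ℕ → ℕ → Word k
digitsLE k zero    n       = []
digitsLE k (suc f) zero    = []
digitsLE k (suc f) (suc n) = ((suc n) mod k) ∷ digitsLE k f ((suc n) / k)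

-- (n)_k : base-k expansion of n, most significant digit first, no leading zeros
-- ((0)_k is the empty word)
expansion : (k : ℕ) → .{{_ : NonZero k}} → ℕ → Word k
expansion k n = reverse (digitsLE k n n)

isPrefix : {k : ℕ} → Word k → Word k → ℕ
isPrefix []      w       = 1
isPrefix (_ ∷ _) []      = 0
isPrefix (a ∷ v) (b ∷ w) with a Fin.≟ b
... | yes _ = isPrefix v w
... | no  _ = 0

occurrences : {k : ℕ} → Word k → Word k → ℕ
occurrences v []      = isPrefix v []
occurrences v (c ∷ w) = isPrefix v (c ∷ w) + occurrences v w

count : (k : ℕ) → .{{_ : NonZero k}} → Word k → ℕ → ℕ
count k v n = occurrences v (replicate (length v ∸ 1) (0 mod k) ++ expansion k n)

IsZeroWord : {k : ℕ} → Word k → Set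
IsZeroWord v = All (λ d → Fin.toℕ d ≡ 0) v

-- admissible set: a finite set of words (list without duplicates) containing
-- no word of the form 0^j
Admissible : {k : ℕ} → List (Word k) → Set
Admissible A = Unique A × All (λ v → ¬ IsZeroWord v) A

patternSeq : (k : ℕ) → .{{_ : NonZero k}} → List (Word k) → ℕ → ℤ
patternSeq k A n = -[1+ 0 ] ^ℤ sum (map (λ v → count k v n) A)

module Submission where

-- The product of two pattern counting sequences a_A · a_B is a_C for the
-- symmetric difference C = A △ B.  Writing σ(a) = (-1)^a and
-- W_f(L) = Σ_{v ∈ L} f v for f = #(·, n), we have a_L(n) = σ(W_f(L)); since
-- σ is a homomorphism (ℕ,+) → (ℤ,·) with σ(a)² = 1, every word lying in both
-- A and B contributes σ(f v)² = 1 to a_A · a_B, which is exactly why it may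
-- be dropped from C.

open import Defs
open import Data.Nat using (ℕ; suc; _+_)
open import Data.Integer using (ℤ; -[1+_]; 1ℤ; _*_) renaming (_^_ to _^ℤ_)
import Data.Integer.Properties as ℤP
import Data.Nat.Properties as ℕP
open import Data.List using (List; []; _∷_; map; foldr)
open import Data.Nat.ListAction using (sum)
import Data.List.Properties as ListP
import Data.Fin as Fin
open import Data.List.Relation.Unary.All using (All; []; _∷_)
open import Data.List.Relation.Unary.All.Properties using (¬Any⇒All¬; ─⁺)
open import Data.List.Relation.Unary.Any using (here; there; _─_)
open import Data.List.Relation.Unary.AllPairs using (_∷_)
open import Data.List.Relation.Unary.Unique.Propositional using (Unique)
open import Data.List.Membership.Propositional using (_∈_)
open import Data.Product using (Σ; _×_; _,_)
open import Relation.Nullary using (yes; no)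
open import Relation.Binary.Definitions using (DecidableEquality)
open import Relation.Binary.PropositionalEquality
  using (_≡_; refl; sym; trans; cong; module ≡-Reasoning)
open import Algebra.Properties.CommutativeSemigroup ℕP.+-commutativeSemigroup
  using () renaming (x∙yz≈y∙xz to +-swapˡ)
open import Algebra.Properties.CommutativeSemigroup ℤP.*-commutativeSemigroup
  using () renaming (x∙yz≈y∙xz to *-swapˡ)

sign : ℕ → ℤ
sign a = -[1+ 0 ] ^ℤ a

sign-+ : ∀ a b → sign (a + b) ≡ sign a * sign b
sign-+ = ℤP.^-distribˡ-+-* -[1+ 0 ]

sign-square : ∀ a → sign a * sign a ≡ 1ℤ
sign-square a = begin
  sign a * sign a          ≡⟨ sym (sign-+ a a) ⟩
  sign (a + a)             ≡⟨ cong (λ b → sign (a + b)) (sym (ℕP.+-identityʳ a)) ⟩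
  sign (a + (a + 0))       ≡⟨ sym (ℤP.^-*-assoc -[1+ 0 ] 2 a) ⟩
  1ℤ ^ℤ a                  ≡⟨ ℤP.^-zeroˡ a ⟩
  1ℤ                       ∎
  where open ≡-Reasoning

sign-cancel : ∀ a {x y} → y ≡ sign a * x → x ≡ sign a * y
sign-cancel a {x} {y} y≡ax = begin
  x                        ≡⟨ sym (ℤP.*-identityˡ x) ⟩
  1ℤ * x                   ≡⟨ cong (_* x) (sym (sign-square a)) ⟩
  (sign a * sign a) * x    ≡⟨ ℤP.*-assoc (sign a) (sign a) x ⟩
  sign a * (sign a * x)    ≡⟨ cong (sign a *_) (sym y≡ax) ⟩
  sign a * y               ∎
  where open ≡-Reasoning

weight : {W : Set} → (W → ℕ) → List W → ℕ
weight f L = sum (map f L)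

weight-─ : {W : Set} (f : W → ℕ) {v : W} (L : List W) (v∈L : v ∈ L) →
           weight f L ≡ f v + weight f (L ─ v∈L)
weight-─ f (x ∷ L) (here refl)  = refl
weight-─ f {v} (x ∷ L) (there v∈L) =
  trans (cong (f x +_) (weight-─ f L v∈L)) (+-swapˡ (f x) (f v) (weight f (L ─ v∈L)))

unique-─ : {W : Set} {v : W} (L : List W) (v∈L : v ∈ L) →
           Unique L → Unique (L ─ v∈L)
unique-─ (x ∷ L) (here refl)  (_ ∷ uL)   = uL
unique-─ (x ∷ L) (there v∈L) (x∉L ∷ uL) = ─⁺ v∈L x∉L ∷ unique-─ L v∈L uL

module SymmetricDifference {W : Set} (_≟_ : DecidableEquality W) where

  open import Data.List.Membership.DecPropositional _≟_ using (_∈?_)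

  toggle : W → List W → List W
  toggle v L with v ∈? L
  ... | yes v∈L = L ─ v∈L
  ... | no  _   = v ∷ L

  _△_ : List W → List W → List W
  A △ B = foldr toggle A B

  sign-toggle : (f : W → ℕ) (v : W) (L : List W) →
                sign (weight f (toggle v L)) ≡ sign (f v) * sign (weight f L)
  sign-toggle f v L with v ∈? L
  ... | no  _   = sign-+ (f v) (weight f L)
  ... | yes v∈L = sign-cancel (f v)
        (trans (cong sign (weight-─ f L v∈L)) (sign-+ (f v) _))

  sign-△ : (f : W → ℕ) (A B : List W) →
           sign (weight f (A △ B)) ≡ sign (weight f A) * sign (weight f B)
  sign-△ f A []      = sym (ℤP.*-identityʳ _)
  sign-△ f A (v ∷ B) = begin
    sign (weight f (toggle v (A △ B)))     ≡⟨ sign-toggle f v (A △ B) ⟩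
    sign (f v) * sign (weight f (A △ B))   ≡⟨ cong (sign (f v) *_) (sign-△ f A B) ⟩
    sign (f v) * (sign (weight f A) * sign (weight f B))
      ≡⟨ *-swapˡ (sign (f v)) (sign (weight f A)) (sign (weight f B)) ⟩
    sign (weight f A) * (sign (f v) * sign (weight f B))
      ≡⟨ cong (sign (weight f A) *_) (sym (sign-+ (f v) (weight f B))) ⟩
    sign (weight f A) * sign (weight f (v ∷ B))   ∎
    where open ≡-Reasoning

  unique-toggle : (v : W) (L : List W) → Unique L → Unique (toggle v L)
  unique-toggle v L uL with v ∈? L
  ... | yes v∈L = unique-─ L v∈L uL
  ... | no  v∉L = ¬Any⇒All¬ L v∉L ∷ uL

  unique-△ : (A B : List W) → Unique A → Unique (A △ B)
  unique-△ A []      uA = uA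
  unique-△ A (v ∷ B) uA = unique-toggle v (A △ B) (unique-△ A B uA)

  all-toggle : {P : W → Set} (v : W) (L : List W) → P v → All P L → All P (toggle v L)
  all-toggle v L pv pL with v ∈? L
  ... | yes v∈L = ─⁺ v∈L pL
  ... | no  _   = pv ∷ pL

  all-△ : {P : W → Set} (A B : List W) → All P A → All P B → All P (A △ B)
  all-△ A []      pA []        = pA
  all-△ A (v ∷ B) pA (pv ∷ pB) = all-toggle v (A △ B) pv (all-△ A B pA pB)

lemma2p1 : (m : ℕ) → (A B : List (Word (suc (suc m)))) →
    Admissible A → Admissible B →
    Σ (List (Word (suc (suc m)))) (λ C → Admissible C ×
    ((n : ℕ) → patternSeq (suc (suc m)) C n
    ≡ patternSeq (suc (suc m)) A n * patternSeq (suc (suc m)) B n))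
lemma2p1 m A B (uniqueA , nonZeroA) (_ , nonZeroB) =
  A △ B ,
  (unique-△ A B uniqueA , all-△ A B nonZeroA nonZeroB) ,
  λ n → sign-△ (λ v → count (suc (suc m)) v n) A B
  where open SymmetricDifference (ListP.≡-dec Fin._≟_)
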